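{- Let $r$ and $n$ be positive integers and $m=rn+1$. Then the Möbius function $\mu(\hat0,\hat1)$ of the lattice $\Pi_m^{r,1}$ equals $0$.
   Context: For positive integers $r,j$, nonnegative $n$ and $m=rn+j$, $\Pi_m^{r,j}$ is the poset of all set partitions $\pi$ of $\{1,\dots,m\}$ such that the block containing $m$ has cardinality at least $j$ and every block not containing $m$ has cardinality divisible by $r$, ordered by refinement, together with a newly adjoined minimum $\hat0$; its maximum $\hat1$ is the one-block partition. (For $j=1$ the first condition is vacuous.) -}

module Defs where

open import Data.Bool using (Bool; true; false; _∧_; _∨_; not; if_then_else_)
import Data.Bool.Properties as BoolP
open import Data.Nat using (ℕ; zero; suc; _+_; _*_; _≥_; _≤ᵇ_)
open import Data.Nat.Divisibility using (_∣?_)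
open import Data.Fin using (Fin; fromℕ)
open import Data.List.Base using (List; []; _∷_; map; concatMap; length; allFin; foldr)
open import Data.Vec using (Vec; lookup; replicate) renaming ([] to []ᵥ; _∷_ to _∷ᵥ_)
import Data.Vec.Properties as VecP
open import Data.Maybe using (Maybe; just; nothing)
import Data.Maybe.Properties as MaybeP
open import Data.Integer using (ℤ; -_) renaming (_+_ to _+ℤ_)
open import Relation.Nullary.Decidable using (⌊_⌋; does)
open import Relation.Binary.Definitions using (DecidableEquality)

-- The poset is given by a list `xs` of its elements (each listed once),
-- a Boolean order relation `leq`, and decidable equality on the carrier.
-- mu(x,x) = 1, mu(x,y) = - Σ_{x ≤ z < y} mu(x,z) for x < y, mu(x,y) = 0 otherwise.
-- The recursion is run with an explicit fuel parameter; fuel ≥ (number of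
-- elements + 1) bounds the length of every chain, so the value is exact.

all : ∀ {A : Set} → (A → Bool) → List A → Bool
all p = foldr (λ x b → p x ∧ b) true

filter : ∀ {A : Set} → (A → Bool) → List A → List A
filter p []       = []
filter p (x ∷ xs) = if p x then x ∷ filter p xs else filter p xs

sumℤ : List ℤ → ℤ
sumℤ = foldr _+ℤ_ (ℤ.pos 0)

module _ {A : Set} (_≟_ : DecidableEquality A) (leq : A → A → Bool) (xs : List A) where

  mobiusFuel : ℕ → A → A → ℤ
  mobiusFuel zero    x y = ℤ.pos 0
  mobiusFuel (suc k) x y =
    if does (x ≟ y) then ℤ.pos 1
    else if leq x y
      then - sumℤ (map (mobiusFuel k x)
                       (filter (λ z → leq x z ∧ leq z y ∧ not (does (z ≟ y))) xs))
      else ℤ.pos 0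

  mobius : A → A → ℤ
  mobius = mobiusFuel (suc (length xs))

-- Set partitions of Fin m, represented by their equivalence relation
-- as a Boolean m×m matrix:  R i j = true  iff  i and j lie in the same block.

Rel : ℕ → Set
Rel m = Vec (Vec Bool m) m

rel : ∀ {m} → Rel m → Fin m → Fin m → Bool
rel R i j = lookup (lookup R i) j

allVecs : ∀ {A : Set} → List A → (n : ℕ) → List (Vec A n)
allVecs xs zero    = []ᵥ ∷ []
allVecs xs (suc n) = concatMap (λ x → map (x ∷ᵥ_) (allVecs xs n)) xs

allRels : (m : ℕ) → List (Rel m)
allRels m = allVecs (allVecs (true ∷ false ∷ []) m) m

_⇒ᵇ_ : Bool → Bool → Bool
a ⇒ᵇ b = not a ∨ b

isEquivRel : ∀ {m} → Rel m → Bool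
isEquivRel {m} R =
  all (λ i → rel R i i) (allFin m) ∧
  all (λ i → all (λ j → rel R i j ⇒ᵇ rel R j i) (allFin m)) (allFin m) ∧
  all (λ i → all (λ j → all (λ k → (rel R i j ∧ rel R j k) ⇒ᵇ rel R i k)
                                 (allFin m)) (allFin m)) (allFin m)

blockSize : ∀ {m} → Rel m → Fin m → ℕ
blockSize {m} R i = length (filter (λ j → rel R i j) (allFin m))

refines : ∀ {m} → Rel m → Rel m → Bool
refines {m} R S = all (λ i → all (λ j → rel R i j ⇒ᵇ rel S i j) (allFin m)) (allFin m)

-- The poset Π^{r,j}_m for m = suc k (so the largest element of {1..m}
-- is `fromℕ k`): partitions whose block containing the largest element
-- has size ≥ j and all other blocks have size divisible by r,
-- with an adjoined minimum 0̂ = nothing.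

admissible : (r j k : ℕ) → Rel (suc k) → Bool
admissible r j k R =
  isEquivRel R ∧
  all (λ i → if rel R i (fromℕ k)
               then j ≤ᵇ blockSize R i
               else ⌊ r ∣? blockSize R i ⌋) (allFin (suc k))

PiElt : ℕ → Set
PiElt m = Maybe (Rel m)

PiLeq : ∀ {m} → PiElt m → PiElt m → Bool
PiLeq nothing  _        = true
PiLeq (just _) nothing  = false
PiLeq (just R) (just S) = refines R S

_≟Pi_ : ∀ {m} → DecidableEquality (PiElt m)
_≟Pi_ = MaybeP.≡-dec (VecP.≡-dec (VecP.≡-dec BoolP._≟_))

PiElements : (r j k : ℕ) → List (PiElt (suc k))
PiElements r j k = nothing ∷ map just (filter (admissible r j k) (allRels (suc k)))

bot : ∀ {m} → PiElt m
bot = nothing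

top : ∀ {m} → PiElt m
top {m} = just (replicate m (replicate m true))

muPi : (r j k : ℕ) → ℤ
muPi r j k = mobius _≟Pi_ PiLeq (PiElements r j k) bot top

module Submission where

-- Write M for the largest point m and S for the set consisting of 0̂ and
-- the partitions in which {M} is a block.  For a partition Z ∉ S let Z̃ be
-- Z with M split off into a singleton block (the meet of Z with
-- {{1..m-1},{M}}).  The block of M in Z minus M is the complement in
-- {1..m-1} of a union of blocks of size divisible by r, and r ∣ m-1, so Z̃
-- is again admissible; moreover the elements of S strictly below Z are
-- exactly the interval [0̂,Z̃].  A general fact about Möbius functions now
-- gives μ(0̂,Z) = 0 by induction on Z: in μ(0̂,Z) = -Σ_{W<Z} μ(0̂,W) the
-- terms with W ∈ S add up to Σ_{W≤Z̃} μ(0̂,W) = 0 and the others vanish.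
-- Since n ≥ 1, the top 1̂ is not in S.

open import Defs
open import Data.Bool using (Bool; true; false; _∧_; not; if_then_else_)
open import Data.Bool.Properties using (∧-conicalˡ; ∧-conicalʳ; not-injective; ¬-not; T-≡)
import Data.Bool.Properties as Bool
open import Data.Nat using (ℕ; zero; suc; _+_; _*_; _≤_; _<_; _≥_; _≤ᵇ_; z≤n; s≤s)
open import Data.Nat.Properties
  using (≤-refl; ≤-trans; <-≤-trans; m<1+n⇒m≤n; m<n⇒m<1+n; m≤n⇒m≤1+n; +-suc; +-comm; suc-injective; ≤⇒≤ᵇ; *-mono-≤)
open import Data.Nat.Divisibility using (_∣_; _∣?_; _∣0; ∣m∣n⇒∣m+n; ∣m+n∣m⇒∣n; m∣m*n)
open import Data.Fin using (Fin; fromℕ; toℕ)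
import Data.Fin as Fin
open import Data.Fin.Properties using (toℕ-fromℕ)
open import Data.List.Base using (List; []; _∷_; _++_; map; concatMap; length; allFin; cartesianProductWith; filterᵇ)
open import Data.List.Properties using (length-tabulate)
open import Data.List.Membership.Propositional using (_∈_)
open import Data.List.Membership.Propositional.Properties
  using (∈-allFin; ∈-map⁺; ∈-map⁻; ∈-cartesianProductWith⁺)
open import Data.List.Relation.Unary.Any using (here; there)
open import Data.List.Relation.Unary.All using (All; []; _∷_)
open import Data.List.Relation.Unary.All.Properties using (All¬⇒¬Any)
open import Data.List.Relation.Unary.AllPairs using ([]; _∷_)
open import Data.List.Relation.Unary.Unique.Propositional using (Unique)
import Data.List.Relation.Unary.Unique.Propositional.Properties as Unique
open import Data.Vec using (Vec; lookup; replicate; tabulate) renaming ([] to []ᵥ; _∷_ to _∷ᵥ_)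
open import Data.Vec.Properties using (∷-injective; lookup∘tabulate; tabulate∘lookup; tabulate-cong; lookup-replicate)
open import Data.Maybe using (just; nothing)
open import Data.Maybe.Properties using (just-injective)
open import Data.Integer using (ℤ; -_; 0ℤ; 1ℤ) renaming (_+_ to _+ℤ_)
open import Data.Integer.Properties using (+-identityʳ; +-inverseʳ; +-assoc) renaming (+-comm to +ℤ-comm)
open import Data.Product using (_×_; _,_; proj₁; proj₂; ∃-syntax)
open import Data.Empty using (⊥-elim)
open import Function using (_∘_)
open import Function.Bundles using (Equivalence)
open import Relation.Nullary using (¬_; Dec; yes; no; does)
open import Relation.Nullary.Decidable using (dec-true; dec-false; T?; ⌊_⌋; isYes≗does)
open import Relation.Binary.Definitions using (DecidableEquality)
open import Relation.Binary.Structures using (IsEquivalence; IsPartialOrder)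
open import Relation.Binary.PropositionalEquality
  using (_≡_; _≢_; refl; sym; trans; cong; cong₂; subst; isEquivalence; module ≡-Reasoning)

true≢false : true ≢ false
true≢false ()

∧-intro : ∀ {a b} → a ≡ true → b ≡ true → a ∧ b ≡ true
∧-intro refl refl = refl

-- `not-injective` at a fixed right-hand side, so that the implicits are inferable
not-true⁻ : ∀ {a} → not a ≡ true → a ≡ false
not-true⁻ = not-injective

⇒ᵇ-elim : ∀ {a b} → (a ⇒ᵇ b) ≡ true → a ≡ true → b ≡ true
⇒ᵇ-elim {true} h refl = h

⇒ᵇ-intro : ∀ {a b} → (a ≡ true → b ≡ true) → (a ⇒ᵇ b) ≡ true
⇒ᵇ-intro {true}  h = h refl
⇒ᵇ-intro {false} h = refl

⇔ᵇ-≡ : ∀ {a b} → (a ≡ true → b ≡ true) → (b ≡ true → a ≡ true) → a ≡ b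
⇔ᵇ-≡ {true}  {true}  _ _ = refl
⇔ᵇ-≡ {true}  {false} f _ = sym (f refl)
⇔ᵇ-≡ {false} {true}  _ g = g refl
⇔ᵇ-≡ {false} {false} _ _ = refl

does-sound : ∀ {P : Set} (p? : Dec P) → does p? ≡ true → P
does-sound (yes p) _ = p

module _ {A : Set} where

  ∈-filter⁺ : (p : A → Bool) {x : A} (xs : List A) → x ∈ xs → p x ≡ true → x ∈ filter p xs
  ∈-filter⁺ p (y ∷ ys) (here refl) px rewrite px = here refl
  ∈-filter⁺ p (y ∷ ys) (there x∈) px with p y
  ... | true  = there (∈-filter⁺ p ys x∈ px)
  ... | false = ∈-filter⁺ p ys x∈ px

  ∈-filter⁻ : (p : A → Bool) {x : A} (xs : List A) → x ∈ filter p xs → x ∈ xs × p x ≡ true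
  ∈-filter⁻ p (y ∷ ys) x∈ with p y in py
  ∈-filter⁻ p (y ∷ ys) (here refl) | true = here refl , py
  ∈-filter⁻ p (y ∷ ys) (there x∈)  | true = let (x∈ys , px) = ∈-filter⁻ p ys x∈ in there x∈ys , px
  ∈-filter⁻ p (y ∷ ys) x∈          | false = let (x∈ys , px) = ∈-filter⁻ p ys x∈ in there x∈ys , px

  filter≡filterᵇ : (p : A → Bool) (xs : List A) → filter p xs ≡ filterᵇ p xs
  filter≡filterᵇ p [] = refl
  filter≡filterᵇ p (x ∷ xs) with p x
  ... | true  = cong (x ∷_) (filter≡filterᵇ p xs)
  ... | false = filter≡filterᵇ p xs

  filter-unique : (p : A → Bool) {xs : List A} → Unique xs → Unique (filter p xs)
  filter-unique p {xs} u = subst Unique (sym (filter≡filterᵇ p xs)) (Unique.filter⁺ (T? ∘ p) u)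

  filter-cong : (p q : A → Bool) (xs : List A) → (∀ x → x ∈ xs → p x ≡ q x) → filter p xs ≡ filter q xs
  filter-cong p q [] _ = refl
  filter-cong p q (y ∷ ys) p≗q rewrite p≗q y (here refl) with q y
  ... | true  = cong (y ∷_) (filter-cong p q ys (λ x x∈ → p≗q x (there x∈)))
  ... | false = filter-cong p q ys (λ x x∈ → p≗q x (there x∈))

  map-cong-∈ : ∀ {B : Set} (f g : A → B) (xs : List A) → (∀ x → x ∈ xs → f x ≡ g x) → map f xs ≡ map g xs
  map-cong-∈ f g [] _ = refl
  map-cong-∈ f g (y ∷ ys) f≗g = cong₂ _∷_ (f≗g y (here refl)) (map-cong-∈ f g ys (λ x x∈ → f≗g x (there x∈)))

  sum-filter-split : (f : A → ℤ) (p q : A → Bool) (xs : List A) →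
    sumℤ (map f (filter p xs)) ≡
    sumℤ (map f (filter (λ x → p x ∧ q x) xs)) +ℤ sumℤ (map f (filter (λ x → p x ∧ not (q x)) xs))
  sum-filter-split f p q [] = refl
  sum-filter-split f p q (y ∷ ys) with p y | q y
  ... | false | _     = sum-filter-split f p q ys
  ... | true  | true  = trans (cong (f y +ℤ_) (sum-filter-split f p q ys)) (sym (+-assoc (f y) _ _))
  ... | true  | false = trans (cong (f y +ℤ_) (sum-filter-split f p q ys))
                                  (swap (f y) (sumℤ (map f (filter (λ x → p x ∧ q x) ys))) _)
    where
    swap : ∀ a b c → a +ℤ (b +ℤ c) ≡ b +ℤ (a +ℤ c)
    swap a b c = trans (sym (+-assoc a b c)) (trans (cong (_+ℤ c) (+ℤ-comm a b)) (+-assoc b a c))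

  length-filter-split : (p q : A → Bool) (xs : List A) →
    length (filter p xs) ≡ length (filter (λ x → p x ∧ q x) xs) + length (filter (λ x → p x ∧ not (q x)) xs)
  length-filter-split p q [] = refl
  length-filter-split p q (y ∷ ys) with p y | q y
  ... | false | _     = length-filter-split p q ys
  ... | true  | true  = cong suc (length-filter-split p q ys)
  ... | true  | false = trans (cong suc (length-filter-split p q ys)) (sym (+-suc _ _))

  length-filter-complement : (p : A → Bool) (xs : List A) →
    length (filter p xs) + length (filter (λ x → not (p x)) xs) ≡ length xs
  length-filter-complement p [] = refl
  length-filter-complement p (y ∷ ys) with p y
  ... | true  = cong suc (length-filter-complement p ys)
  ... | false = trans (+-suc _ _) (cong suc (length-filter-complement p ys))

  length-filter-≤ : (p : A → Bool) (xs : List A) → length (filter p xs) ≤ length xs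
  length-filter-≤ p [] = z≤n
  length-filter-≤ p (y ∷ ys) with p y
  ... | true  = s≤s (length-filter-≤ p ys)
  ... | false = m≤n⇒m≤1+n (length-filter-≤ p ys)

  length-filter-mono : (p q : A → Bool) (xs : List A) → (∀ x → x ∈ xs → p x ≡ true → q x ≡ true) →
    length (filter p xs) ≤ length (filter q xs)
  length-filter-mono p q [] _ = z≤n
  length-filter-mono p q (y ∷ ys) p⇒q with p y in py | q y in qy
  ... | true  | true  = s≤s (length-filter-mono p q ys (λ x x∈ → p⇒q x (there x∈)))
  ... | true  | false = ⊥-elim (true≢false (trans (sym (p⇒q y (here refl) py)) qy))
  ... | false | true  = m≤n⇒m≤1+n (length-filter-mono p q ys (λ x x∈ → p⇒q x (there x∈)))
  ... | false | false = length-filter-mono p q ys (λ x x∈ → p⇒q x (there x∈))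

  length-filter-< : (p q : A → Bool) (xs : List A) → (∀ x → x ∈ xs → p x ≡ true → q x ≡ true) →
    ∀ {z} → z ∈ xs → q z ≡ true → p z ≡ false → length (filter p xs) < length (filter q xs)
  length-filter-< p q (y ∷ ys) p⇒q (here refl) qz pz
    rewrite qz | pz = s≤s (length-filter-mono p q ys (λ x x∈ → p⇒q x (there x∈)))
  length-filter-< p q (y ∷ ys) p⇒q (there z∈) qz pz with p y in py | q y in qy
  ... | true  | true  = s≤s (length-filter-< p q ys (λ x x∈ → p⇒q x (there x∈)) z∈ qz pz)
  ... | true  | false = ⊥-elim (true≢false (trans (sym (p⇒q y (here refl) py)) qy))
  ... | false | true  = m<n⇒m<1+n (length-filter-< p q ys (λ x x∈ → p⇒q x (there x∈)) z∈ qz pz)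
  ... | false | false = length-filter-< p q ys (λ x x∈ → p⇒q x (there x∈)) z∈ qz pz

  filter-witness : (p : A → Bool) (xs : List A) → 0 < length (filter p xs) → ∃[ x ] p x ≡ true
  filter-witness p (y ∷ ys) h with p y in py
  ... | true  = y , py
  ... | false = filter-witness p ys h

  filter-≟-singleton : (_≟_ : DecidableEquality A) (c : A) (xs : List A) → Unique xs → c ∈ xs →
    filter (λ w → does (w ≟ c)) xs ≡ c ∷ []
  filter-≟-singleton _≟_ c (y ∷ ys) (c∉ys ∷ _) (here refl)
    rewrite dec-true (c ≟ c) refl = cong (c ∷_) (none ys c∉ys)
    where
    none : ∀ zs → All (c ≢_) zs → filter (λ w → does (w ≟ c)) zs ≡ []
    none [] [] = refl
    none (z ∷ zs) (c≢z ∷ c∉zs) rewrite dec-false (z ≟ c) (λ z≡c → c≢z (sym z≡c)) = none zs c∉zs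
  filter-≟-singleton _≟_ c (y ∷ ys) (y∉ys ∷ u) (there c∈)
    rewrite dec-false (y ≟ c) (λ { refl → All¬⇒¬Any y∉ys c∈ }) = filter-≟-singleton _≟_ c ys u c∈

  sum-zero : (f : A → ℤ) (xs : List A) → (∀ x → x ∈ xs → f x ≡ 0ℤ) → sumℤ (map f xs) ≡ 0ℤ
  sum-zero f [] _ = refl
  sum-zero f (y ∷ ys) f≡0 rewrite f≡0 y (here refl) | sum-zero f ys (λ x x∈ → f≡0 x (there x∈)) = refl

  all⁻ : (p : A → Bool) (xs : List A) → all p xs ≡ true → ∀ x → x ∈ xs → p x ≡ true
  all⁻ p (y ∷ ys) h x (here refl) = ∧-conicalˡ _ _ h
  all⁻ p (y ∷ ys) h x (there x∈) = all⁻ p ys (∧-conicalʳ (p y) _ h) x x∈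

  all⁺ : (p : A → Bool) (xs : List A) → (∀ x → x ∈ xs → p x ≡ true) → all p xs ≡ true
  all⁺ p [] _ = refl
  all⁺ p (y ∷ ys) h = ∧-intro (h y (here refl)) (all⁺ p ys (λ x x∈ → h x (there x∈)))

  all-false⁺ : (p : A → Bool) (xs : List A) → ∀ {x} → x ∈ xs → p x ≡ false → all p xs ≡ false
  all-false⁺ p (y ∷ ys) (here refl) px rewrite px = refl
  all-false⁺ p (y ∷ ys) (there x∈) px with p y
  ... | true  = all-false⁺ p ys x∈ px
  ... | false = refl

module Möbius {A : Set} (_≟_ : DecidableEquality A) (_⊑_ : A → A → Bool) (xs : List A) (⊥ₚ : A)
  (isPartialOrder : IsPartialOrder _≡_ (λ a b → a ⊑ b ≡ true))
  (⊥ₚ-least : ∀ a → ⊥ₚ ⊑ a ≡ true)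
  (xs-unique : Unique xs) where

  open IsPartialOrder isPartialOrder using (antisym) renaming (refl to ⊑-refl; trans to ⊑-trans)
  open ≡-Reasoning

  _⊏_ : A → A → Bool
  w ⊏ y = w ⊑ y ∧ not (does (w ≟ y))

  below : A → List A
  below y = filter (_⊏ y) xs

  height : A → ℕ
  height y = length (below y)

  μ : A → ℤ
  μ = mobius _≟_ _⊑_ xs ⊥ₚ

  μ[_] : ℕ → A → ℤ
  μ[ k ] = mobiusFuel _≟_ _⊑_ xs k ⊥ₚ

  ⊏⇒⊑ : ∀ {w y} → w ⊏ y ≡ true → w ⊑ y ≡ true
  ⊏⇒⊑ = ∧-conicalˡ _ _

  ⊏⇒≢ : ∀ {w y} → w ⊏ y ≡ true → w ≢ y
  ⊏⇒≢ {w} {y} w⊏y w≡y = true≢false (trans (sym (dec-true (w ≟ y) w≡y)) (not-true⁻ (∧-conicalʳ (w ⊑ y) _ w⊏y)))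

  ⊏-trans : ∀ {u w y} → u ⊏ w ≡ true → w ⊏ y ≡ true → u ⊏ y ≡ true
  ⊏-trans {u} {w} {y} u⊏w w⊏y = ∧-intro (⊑-trans (⊏⇒⊑ u⊏w) (⊏⇒⊑ w⊏y)) (cong not (dec-false (u ≟ y) u≢y))
    where
    u≢y : u ≢ y
    u≢y refl = ⊏⇒≢ u⊏w (antisym (⊏⇒⊑ u⊏w) (⊏⇒⊑ w⊏y))

  height-⊏ : ∀ {w y} → w ∈ xs → w ⊏ y ≡ true → height w < height y
  height-⊏ {w} {y} w∈ w⊏y =
    length-filter-< (_⊏ w) (_⊏ y) xs (λ u _ u⊏w → ⊏-trans u⊏w w⊏y) w∈ w⊏y (¬-not (λ w⊏w → ⊏⇒≢ w⊏w refl))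

  height-below : ∀ {w y a} → w ∈ below y → height y < suc a → height w < a
  height-below {w} {y} w∈ hy = let (w∈xs , w⊏y) = ∈-filter⁻ (_⊏ y) xs w∈ in
    <-≤-trans (height-⊏ w∈xs w⊏y) (m<1+n⇒m≤n hy)

  height-≤ : ∀ y → height y ≤ length xs
  height-≤ y = length-filter-≤ (_⊏ y) xs

  fuel-bottom : ∀ k → μ[ suc k ] ⊥ₚ ≡ 1ℤ
  fuel-bottom k rewrite dec-true (⊥ₚ ≟ ⊥ₚ) refl = refl

  fuel-step : ∀ k {y} → ⊥ₚ ≢ y → μ[ suc k ] y ≡ - sumℤ (map μ[ k ] (below y))
  fuel-step k {y} ⊥≢y rewrite dec-false (⊥ₚ ≟ y) ⊥≢y | ⊥ₚ-least y =
    cong (λ ws → - sumℤ (map μ[ k ] ws)) (filter-cong _ _ xs (λ w _ → cong (_∧ (w ⊏ y)) (⊥ₚ-least w)))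

  fuel-stable : ∀ a b y → height y < a → height y < b → μ[ a ] y ≡ μ[ b ] y
  fuel-stable (suc a) (suc b) y ha hb = by-cases (⊥ₚ ≟ y)
    where
    by-cases : Dec (⊥ₚ ≡ y) → μ[ suc a ] y ≡ μ[ suc b ] y
    by-cases (yes ⊥≡y) = subst (λ t → μ[ suc a ] t ≡ μ[ suc b ] t) ⊥≡y (trans (fuel-bottom a) (sym (fuel-bottom b)))
    by-cases (no ⊥≢y) = begin
      μ[ suc a ] y                    ≡⟨ fuel-step a ⊥≢y ⟩
      - sumℤ (map μ[ a ] (below y))   ≡⟨ cong (λ ts → - sumℤ ts) (map-cong-∈ μ[ a ] μ[ b ] (below y)
                                           (λ w w∈ → fuel-stable a b w (height-below w∈ ha) (height-below w∈ hb))) ⟩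
      - sumℤ (map μ[ b ] (below y))   ≡⟨ sym (fuel-step b ⊥≢y) ⟩
      μ[ suc b ] y                    ∎

  μ-recursion : ∀ {y} → ⊥ₚ ≢ y → μ y ≡ - sumℤ (map μ (below y))
  μ-recursion {y} ⊥≢y = begin
    μ y                             ≡⟨ fuel-step L ⊥≢y ⟩
    - sumℤ (map μ[ L ] (below y))   ≡⟨ cong (λ ts → - sumℤ ts) (map-cong-∈ μ[ L ] μ (below y) enough-fuel) ⟩
    - sumℤ (map μ (below y))        ∎
    where
    L : ℕ
    L = length xs
    enough-fuel : ∀ w → w ∈ below y → μ[ L ] w ≡ μ w
    enough-fuel w w∈ = let hw = height-below w∈ (s≤s (height-≤ y)) in fuel-stable L (suc L) w hw (m<n⇒m<1+n hw)

  μ-downset-sum : ∀ {c} → c ∈ xs → ⊥ₚ ≢ c → sumℤ (map μ (filter (_⊑ c) xs)) ≡ 0ℤ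
  μ-downset-sum {c} c∈ ⊥≢c = begin
    sumℤ (map μ (filter (_⊑ c) xs))
      ≡⟨ sum-filter-split μ (_⊑ c) (λ w → not (does (w ≟ c))) xs ⟩
    Σbelow +ℤ sumℤ (map μ (filter (λ w → w ⊑ c ∧ not (not (does (w ≟ c)))) xs))
      ≡⟨ cong (λ ws → Σbelow +ℤ sumℤ (map μ ws)) (trans (filter-cong _ _ xs (λ w _ → only-c w))
                                                           (filter-≟-singleton _≟_ c xs xs-unique c∈)) ⟩
    Σbelow +ℤ (μ c +ℤ 0ℤ)
      ≡⟨ cong (λ t → Σbelow +ℤ t) (trans (+-identityʳ (μ c)) (μ-recursion ⊥≢c)) ⟩
    Σbelow +ℤ (- Σbelow)
      ≡⟨ +-inverseʳ Σbelow ⟩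
    0ℤ ∎
    where
    Σbelow : ℤ
    Σbelow = sumℤ (map μ (below c))
    only-c : ∀ w → w ⊑ c ∧ not (not (does (w ≟ c))) ≡ does (w ≟ c)
    only-c w with w ≟ c
    ... | yes refl rewrite ⊑-refl {w} = refl
    ... | no _ = Bool.∧-zeroʳ (w ⊑ c)

  module Vanishing (S : A → Bool) (S-⊥ : S ⊥ₚ ≡ true)
    (interval : ∀ z → z ∈ xs → S z ≡ false →
       ∃[ c ] c ∈ xs × ⊥ₚ ≢ c × (∀ w → w ∈ xs → (w ⊏ z ∧ S w) ≡ w ⊑ c)) where

    μ-vanishes-bounded : ∀ a z → z ∈ xs → S z ≡ false → height z < a → μ z ≡ 0ℤ
    μ-vanishes-bounded (suc a) z z∈ z∉S hz with interval z z∈ z∉S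
    ... | c , c∈ , ⊥≢c , S-below-z≡[⊥,c] = begin
      μ z                                   ≡⟨ μ-recursion ⊥≢z ⟩
      - sumℤ (map μ (below z))              ≡⟨ cong -_ (sum-filter-split μ (_⊏ z) S xs) ⟩
      - (sumℤ (map μ (filter (λ w → w ⊏ z ∧ S w) xs)) +ℤ sumℤ (map μ (filter (λ w → w ⊏ z ∧ not (S w)) xs)))
                                            ≡⟨ cong₂ (λ s t → - (s +ℤ t)) in-S outside-S ⟩
      0ℤ                                    ∎
      where
      ⊥≢z : ⊥ₚ ≢ z
      ⊥≢z refl = true≢false (trans (sym S-⊥) z∉S)
      in-S : sumℤ (map μ (filter (λ w → w ⊏ z ∧ S w) xs)) ≡ 0ℤ
      in-S = trans (cong (λ ws → sumℤ (map μ ws)) (filter-cong _ _ xs S-below-z≡[⊥,c])) (μ-downset-sum c∈ ⊥≢c)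
      outside-S : sumℤ (map μ (filter (λ w → w ⊏ z ∧ not (S w)) xs)) ≡ 0ℤ
      outside-S = sum-zero μ _ λ w w∈ →
        let (w∈xs , hw) = ∈-filter⁻ (λ w → w ⊏ z ∧ not (S w)) xs w∈ in
        μ-vanishes-bounded a w w∈xs (not-true⁻ (∧-conicalʳ (w ⊏ z) _ hw))
          (<-≤-trans (height-⊏ w∈xs (∧-conicalˡ _ _ hw)) (m<1+n⇒m≤n hz))

    μ-vanishes : ∀ z → z ∈ xs → S z ≡ false → μ z ≡ 0ℤ
    μ-vanishes z z∈ z∉S = μ-vanishes-bounded (suc (height z)) z z∈ z∉S ≤-refl

-- Partitions of Fin m as Boolean matrices

allFin⁻ : ∀ {m} (p : Fin m → Bool) → all p (allFin m) ≡ true → ∀ i → p i ≡ true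
allFin⁻ {m} p h i = all⁻ p (allFin m) h i (∈-allFin i)

allFin⁺ : ∀ {m} (p : Fin m → Bool) → (∀ i → p i ≡ true) → all p (allFin m) ≡ true
allFin⁺ {m} p h = all⁺ p (allFin m) (λ i _ → h i)

IsPartition : ∀ {m} → Rel m → Set
IsPartition R = IsEquivalence (λ i j → rel R i j ≡ true)

reflexiveᵇ symmetricᵇ transitiveᵇ : ∀ {m} → Rel m → Bool
reflexiveᵇ  {m} R = all (λ i → rel R i i) (allFin m)
symmetricᵇ  {m} R = all (λ i → all (λ j → rel R i j ⇒ᵇ rel R j i) (allFin m)) (allFin m)
transitiveᵇ {m} R =
  all (λ i → all (λ j → all (λ l → (rel R i j ∧ rel R j l) ⇒ᵇ rel R i l) (allFin m)) (allFin m)) (allFin m)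

isEquivRel⁻ : ∀ {m} (R : Rel m) → isEquivRel R ≡ true → IsPartition R
isEquivRel⁻ {m} R h = record
  { refl  = λ {i} → allFin⁻ _ (∧-conicalˡ (reflexiveᵇ R) _ h) i
  ; sym   = λ {i} {j} → ⇒ᵇ-elim (allFin⁻ (λ j → rel R i j ⇒ᵇ rel R j i) (allFin⁻ _ symmetric i) j)
  ; trans = λ {i} {j} {l} Rij Rjl →
      ⇒ᵇ-elim (allFin⁻ (λ l → (rel R i j ∧ rel R j l) ⇒ᵇ rel R i l)
                 (allFin⁻ (λ j → all (λ l → (rel R i j ∧ rel R j l) ⇒ᵇ rel R i l) (allFin m))
                    (allFin⁻ _ transitive i) j) l)
              (∧-intro Rij Rjl)
  }
  where
  symmetric : symmetricᵇ R ≡ true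
  symmetric = ∧-conicalˡ (symmetricᵇ R) _ (∧-conicalʳ (reflexiveᵇ R) _ h)
  transitive : transitiveᵇ R ≡ true
  transitive = ∧-conicalʳ (symmetricᵇ R) _ (∧-conicalʳ (reflexiveᵇ R) _ h)

isEquivRel⁺ : ∀ {m} (R : Rel m) → IsPartition R → isEquivRel R ≡ true
isEquivRel⁺ R P = ∧-intro (allFin⁺ (λ i → rel R i i) (λ i → ∼-refl))
  (∧-intro (allFin⁺ _ (λ i → allFin⁺ (λ j → rel R i j ⇒ᵇ rel R j i) (λ j → ⇒ᵇ-intro ∼-sym)))
           (allFin⁺ _ (λ i → allFin⁺ _ (λ j → allFin⁺ (λ l → (rel R i j ∧ rel R j l) ⇒ᵇ rel R i l)
              (λ l → ⇒ᵇ-intro (λ h → ∼-trans (∧-conicalˡ _ _ h) (∧-conicalʳ (rel R i j) _ h)))))))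
  where open IsEquivalence P renaming (refl to ∼-refl; sym to ∼-sym; trans to ∼-trans)

refines⁻ : ∀ {m} (R S : Rel m) → refines R S ≡ true → ∀ i j → rel R i j ≡ true → rel S i j ≡ true
refines⁻ R S h i j = ⇒ᵇ-elim (allFin⁻ _ (allFin⁻ _ h i) j)

refines⁺ : ∀ {m} (R S : Rel m) → (∀ i j → rel R i j ≡ true → rel S i j ≡ true) → refines R S ≡ true
refines⁺ R S h = allFin⁺ _ (λ i → allFin⁺ _ (λ j → ⇒ᵇ-intro (h i j)))

rel-ext : ∀ {m} (R S : Rel m) → (∀ i j → rel R i j ≡ rel S i j) → R ≡ S
rel-ext R S h = vec-ext R S (λ i → vec-ext (lookup R i) (lookup S i) (h i))
  where
  vec-ext : ∀ {A : Set} {n} (u v : Vec A n) → (∀ i → lookup u i ≡ lookup v i) → u ≡ v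
  vec-ext u v h = trans (sym (tabulate∘lookup u)) (trans (tabulate-cong h) (tabulate∘lookup v))

count : ∀ {m} → (Fin m → Bool) → ℕ
count {m} p = length (filter p (allFin m))

count-all : ∀ {m} (p : Fin m → Bool) → count p + count (λ i → not (p i)) ≡ m
count-all {m} p = trans (length-filter-complement p (allFin m)) (length-tabulate (λ i → i))

blockSize-pos : ∀ {m} (R : Rel m) → IsPartition R → ∀ i → 1 ≤ blockSize R i
blockSize-pos {m} R P i = nonempty (filter (rel R i) (allFin m)) (∈-filter⁺ (rel R i) (allFin m) (∈-allFin i) (IsEquivalence.refl P))
  where
  nonempty : ∀ {A : Set} {x : A} (ys : List A) → x ∈ ys → 1 ≤ length ys
  nonempty (_ ∷ _) _ = s≤s z≤n

module Blocks {m} (R : Rel m) (P : IsPartition R) where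

  open IsEquivalence P renaming (refl to ∼-refl; sym to ∼-sym; trans to ∼-trans)

  UnionOfBlocks : (Fin m → Bool) → Set
  UnionOfBlocks U = ∀ {i j} → U i ≡ true → rel R i j ≡ true → U j ≡ true

  _∖block_ : (Fin m → Bool) → Fin m → Fin m → Bool
  (U ∖block i) j = U j ∧ not (rel R i j)

  ∖block-union : ∀ {U} i → UnionOfBlocks U → UnionOfBlocks (U ∖block i)
  ∖block-union {U} i U-union {j} {l} j∈ Rjl =
    ∧-intro (U-union (∧-conicalˡ _ _ j∈) Rjl)
            (cong not (¬-not (λ Ril → true≢false (trans (sym (∼-trans Ril (∼-sym Rjl))) (not-true⁻ (∧-conicalʳ (U j) _ j∈))))))

  count-∖block : ∀ {U} i → UnionOfBlocks U → U i ≡ true → count U ≡ blockSize R i + count (U ∖block i)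
  count-∖block {U} i U-union Ui = trans (length-filter-split U (rel R i) (allFin m))
    (cong (λ n → n + count (U ∖block i)) (cong length (filter-cong _ _ (allFin m) (λ j _ → block⊆U j))))
    where
    block⊆U : ∀ j → U j ∧ rel R i j ≡ rel R i j
    block⊆U j with rel R i j in Rij
    ... | true  rewrite U-union Ui Rij = refl
    ... | false = Bool.∧-zeroʳ (U j)

  count-∖block-< : ∀ {U} i → U i ≡ true → count (U ∖block i) < count U
  count-∖block-< {U} i Ui = length-filter-< (U ∖block i) U (allFin m) (λ j _ → ∧-conicalˡ _ _) (∈-allFin i) Ui
    (trans (cong (λ b → U i ∧ not b) ∼-refl) (Bool.∧-zeroʳ (U i)))

  union-of-blocks-∣ : ∀ d U → UnionOfBlocks U → (∀ i → U i ≡ true → d ∣ blockSize R i) → d ∣ count U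
  union-of-blocks-∣ d U = bounded (count U) U ≤-refl
    where
    bounded : ∀ N U → count U ≤ N → UnionOfBlocks U → (∀ i → U i ≡ true → d ∣ blockSize R i) → d ∣ count U
    bounded N U _ _ _ with count U in count≡
    bounded N       U _  _       _       | zero = d ∣0
    bounded (suc N) U le U-union blocks∣ | suc c with filter-witness U (allFin m) (subst (0 <_) (sym count≡) (s≤s z≤n))
    ... | i , Ui = subst (d ∣_) (trans (sym (count-∖block i U-union Ui)) count≡)
      (∣m∣n⇒∣m+n (blocks∣ i Ui)
        (bounded N (U ∖block i)
          (≤-trans (m<1+n⇒m≤n (subst (count (U ∖block i) <_) count≡ (count-∖block-< i Ui))) (m<1+n⇒m≤n le))
          (∖block-union i U-union) (λ j j∈ → blocks∣ j (∧-conicalˡ _ _ j∈))))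

-- The poset Π^{r,j}_{k+1}: enumeration and order

allVecs-suc : ∀ {A : Set} (xs : List A) n → allVecs xs (suc n) ≡ cartesianProductWith _∷ᵥ_ xs (allVecs xs n)
allVecs-suc xs n = go xs
  where
  go : ∀ ys → concatMap (λ x → map (x ∷ᵥ_) (allVecs xs n)) ys ≡ cartesianProductWith _∷ᵥ_ ys (allVecs xs n)
  go [] = refl
  go (y ∷ ys) = cong (map (y ∷ᵥ_) (allVecs xs n) ++_) (go ys)

∈-allVecs : ∀ {A : Set} (xs : List A) → (∀ a → a ∈ xs) → ∀ {n} (v : Vec A n) → v ∈ allVecs xs n
∈-allVecs xs xs-complete []ᵥ = here refl
∈-allVecs xs xs-complete {suc n} (a ∷ᵥ v) = subst (_ ∈_) (sym (allVecs-suc xs n))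
  (∈-cartesianProductWith⁺ _∷ᵥ_ (xs-complete a) (∈-allVecs xs xs-complete v))

allVecs-unique : ∀ {A : Set} {xs : List A} → Unique xs → ∀ n → Unique (allVecs xs n)
allVecs-unique u zero = [] ∷ []
allVecs-unique {xs = xs} u (suc n) = subst Unique (sym (allVecs-suc xs n))
  (Unique.cartesianProductWith⁺ _∷ᵥ_ ∷-injective u (allVecs-unique u n))

booleans : List Bool
booleans = true ∷ false ∷ []

∈-booleans : ∀ b → b ∈ booleans
∈-booleans true  = here refl
∈-booleans false = there (here refl)

booleans-unique : Unique booleans
booleans-unique = ((λ ()) ∷ []) ∷ [] ∷ []

∈-PiElements⁺ : ∀ r j k (R : Rel (suc k)) → admissible r j k R ≡ true → just R ∈ PiElements r j k
∈-PiElements⁺ r j k R adm = there (∈-map⁺ just (∈-filter⁺ (admissible r j k) (allRels (suc k))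
  (∈-allVecs _ (∈-allVecs _ ∈-booleans) R) adm))

∈-PiElements⁻ : ∀ r j k (R : Rel (suc k)) → just R ∈ PiElements r j k → admissible r j k R ≡ true
∈-PiElements⁻ r j k R (there R∈) with ∈-map⁻ just R∈
... | R′ , R′∈ , refl = proj₂ (∈-filter⁻ (admissible r j k) (allRels (suc k)) R′∈)

PiElements-unique : ∀ r j k → Unique (PiElements r j k)
PiElements-unique r j k =
  nothing∉ (filter (admissible r j k) (allRels (suc k)))
  ∷ Unique.map⁺ just-injective (filter-unique (admissible r j k) (allVecs-unique (allVecs-unique booleans-unique (suc k)) (suc k)))
  where
  nothing∉ : ∀ Rs → All (nothing ≢_) (map just Rs)
  nothing∉ [] = []
  nothing∉ (R ∷ Rs) = (λ ()) ∷ nothing∉ Rs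

PiLeq-isPartialOrder : ∀ {m} → IsPartialOrder _≡_ (λ (a b : PiElt m) → PiLeq a b ≡ true)
PiLeq-isPartialOrder = record
  { isPreorder = record
      { isEquivalence = isEquivalence
      ; reflexive     = λ { {a} refl → reflexive a }
      ; trans         = λ {a} {b} {c} → transitive a b c
      }
  ; antisym = λ {a} {b} → antisymmetric a b
  }
  where
  reflexive : ∀ {m} (a : PiElt m) → PiLeq a a ≡ true
  reflexive nothing  = refl
  reflexive (just R) = refines⁺ R R (λ i j Rij → Rij)
  transitive : ∀ {m} (a b c : PiElt m) → PiLeq a b ≡ true → PiLeq b c ≡ true → PiLeq a c ≡ true
  transitive nothing  _        _        _   _   = refl
  transitive (just R) (just S) (just T) R⊑S S⊑T = refines⁺ R T (λ i j Rij → refines⁻ S T S⊑T i j (refines⁻ R S R⊑S i j Rij))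
  antisymmetric : ∀ {m} (a b : PiElt m) → PiLeq a b ≡ true → PiLeq b a ≡ true → a ≡ b
  antisymmetric nothing  nothing  _   _   = refl
  antisymmetric (just R) (just S) R⊑S S⊑R = cong just (rel-ext R S (λ i j → ⇔ᵇ-≡ (refines⁻ R S R⊑S i j) (refines⁻ S R S⊑R i j)))

module _ (r j k : ℕ) where

  private
    M : Fin (suc k)
    M = fromℕ k

  admissible⁺ : ∀ R → IsPartition R → (∀ i → rel R i M ≡ true → j ≤ blockSize R i) →
    (∀ i → rel R i M ≡ false → r ∣ blockSize R i) → admissible r j k R ≡ true
  admissible⁺ R P block-of-M other-blocks = ∧-intro (isEquivRel⁺ R P) (allFin⁺ _ block-condition)
    where
    block-condition : ∀ i → (if rel R i M then j ≤ᵇ blockSize R i else ⌊ r ∣? blockSize R i ⌋) ≡ true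
    block-condition i with rel R i M in RiM
    ... | true  = Equivalence.to T-≡ (≤⇒≤ᵇ (block-of-M i RiM))
    ... | false = trans (isYes≗does (r ∣? blockSize R i)) (dec-true (r ∣? blockSize R i) (other-blocks i RiM))

  admissible⁻-partition : ∀ R → admissible r j k R ≡ true → IsPartition R
  admissible⁻-partition R adm = isEquivRel⁻ R (∧-conicalˡ _ _ adm)

  admissible⁻-other-blocks : ∀ R → admissible r j k R ≡ true → ∀ i → rel R i M ≡ false → r ∣ blockSize R i
  admissible⁻-other-blocks R adm i RiM = does-sound (r ∣? blockSize R i) (trans (sym (isYes≗does _))
    (subst (λ b → (if b then j ≤ᵇ blockSize R i else ⌊ r ∣? blockSize R i ⌋) ≡ true) RiM
      (allFin⁻ _ (∧-conicalʳ (isEquivRel R) _ adm) i)))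

-- Splitting the largest point M off its block, in Π^{r,1}_{k+1} with r ∣ k

module SplitOff (r k : ℕ) (r∣k : r ∣ k) where

  m : ℕ
  m = suc k

  M : Fin m
  M = fromℕ k

  isM : Fin m → Bool
  isM i = does (i Fin.≟ M)

  Π : List (PiElt m)
  Π = PiElements r 1 k

  open Möbius _≟Pi_ PiLeq Π bot PiLeq-isPartialOrder (λ _ → refl) (PiElements-unique r 1 k)

  MAlone : Rel m → Bool
  MAlone R = all (λ i → rel R M i ⇒ᵇ isM i) (allFin m)

  S : PiElt m → Bool
  S nothing  = true
  S (just R) = MAlone R

  MAlone⁻ : ∀ R → MAlone R ≡ true → ∀ i → rel R M i ≡ true → isM i ≡ true
  MAlone⁻ R alone i = ⇒ᵇ-elim (allFin⁻ (λ i → rel R M i ⇒ᵇ isM i) alone i)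

  isM-true : ∀ {i} → isM i ≡ true → i ≡ M
  isM-true {i} = does-sound (i Fin.≟ M)

  MAlone-respects-isM : ∀ W → IsPartition W → MAlone W ≡ true → ∀ i j → rel W i j ≡ true → isM i ≡ isM j
  MAlone-respects-isM W P alone i j Wij with isM i in isMi | isM j in isMj
  ... | true  | true  = refl
  ... | false | false = refl
  ... | true  | false = sym (trans (sym isMj) (MAlone⁻ W alone j (subst (λ t → rel W t j ≡ true) (isM-true isMi) Wij)))
  ... | false | true  = trans (sym isMi)
          (MAlone⁻ W alone i (IsEquivalence.sym P (subst (λ t → rel W i t ≡ true) (isM-true isMj) Wij)))

  -- Z̃: the meet of Z with the partition {{1..k},{M}}
  splitOff : Rel m → Rel m
  splitOff Z = tabulate (λ i → tabulate (λ j → rel Z i j ∧ does (isM i Bool.≟ isM j)))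

  rel-splitOff : ∀ Z i j → rel (splitOff Z) i j ≡ rel Z i j ∧ does (isM i Bool.≟ isM j)
  rel-splitOff Z i j =
    trans (cong (λ row → lookup row j) (lookup∘tabulate (λ i → tabulate (λ j → rel Z i j ∧ does (isM i Bool.≟ isM j))) i))
          (lookup∘tabulate (λ j → rel Z i j ∧ does (isM i Bool.≟ isM j)) j)

  splitOff⁻ : ∀ Z i j → rel (splitOff Z) i j ≡ true → rel Z i j ≡ true × isM i ≡ isM j
  splitOff⁻ Z i j h = let h′ = trans (sym (rel-splitOff Z i j)) h in
    ∧-conicalˡ _ _ h′ , does-sound (isM i Bool.≟ isM j) (∧-conicalʳ (rel Z i j) _ h′)

  splitOff⁺ : ∀ Z i j → rel Z i j ≡ true → isM i ≡ isM j → rel (splitOff Z) i j ≡ true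
  splitOff⁺ Z i j Zij same = trans (rel-splitOff Z i j) (∧-intro Zij (dec-true (isM i Bool.≟ isM j) same))

  splitOff-partition : ∀ Z → IsPartition Z → IsPartition (splitOff Z)
  splitOff-partition Z P = record
    { refl  = λ {i} → splitOff⁺ Z i i ∼-refl refl
    ; sym   = λ {i} {j} h → let (Zij , same) = splitOff⁻ Z i j h in splitOff⁺ Z j i (∼-sym Zij) (sym same)
    ; trans = λ {i} {j} {l} h h′ → let (Zij , sameij) = splitOff⁻ Z i j h ; (Zjl , samejl) = splitOff⁻ Z j l h′ in
                splitOff⁺ Z i l (∼-trans Zij Zjl) (trans sameij samejl)
    }
    where open IsEquivalence P renaming (refl to ∼-refl; sym to ∼-sym; trans to ∼-trans)

  blockSize-splitOff : ∀ Z i → isM i ≡ false → blockSize (splitOff Z) i ≡ count (λ j → rel Z i j ∧ not (isM j))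
  blockSize-splitOff Z i isMi = cong length (filter-cong _ _ (allFin m) (λ j _ →
    trans (rel-splitOff Z i j) (trans (cong (λ b → rel Z i j ∧ does (b Bool.≟ isM j)) isMi)
                                      (cong (rel Z i j ∧_) (false≟ (isM j))))))
    where
    false≟ : ∀ b → does (false Bool.≟ b) ≡ not b
    false≟ true  = refl
    false≟ false = refl

  -- the block of M with M removed has size divisible by r: its complement
  -- in {1..k} is a union of blocks of sizes divisible by r, and r ∣ k
  block-of-M-minus-M-∣ : ∀ Z → admissible r 1 k Z ≡ true → r ∣ count (λ j → rel Z M j ∧ not (isM j))
  block-of-M-minus-M-∣ Z adm = ∣m+n∣m⇒∣n (subst (r ∣_) k≡outside+rest r∣k) outside-∣
    where
    P : IsPartition Z
    P = admissible⁻-partition r 1 k Z adm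
    open IsEquivalence P renaming (refl to ∼-refl; sym to ∼-sym; trans to ∼-trans)
    inM : Fin m → Bool
    inM = rel Z M
    rest outside : ℕ
    rest = count (λ j → inM j ∧ not (isM j))
    outside = count (λ j → not (inM j))
    M-only : count (λ j → inM j ∧ isM j) ≡ 1
    M-only = cong length (trans (filter-cong _ (λ j → does (j Fin.≟ M)) (allFin m) (λ j _ → is-M j))
                                (filter-≟-singleton Fin._≟_ M (allFin m) (Unique.allFin⁺ m) (∈-allFin M)))
      where
      is-M : ∀ j → inM j ∧ isM j ≡ does (j Fin.≟ M)
      is-M j with j Fin.≟ M
      ... | yes refl rewrite ∼-refl {M} = refl
      ... | no _ = Bool.∧-zeroʳ (inM j)
    k≡outside+rest : k ≡ outside + rest
    k≡outside+rest = suc-injective (begin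
      suc k                      ≡⟨ sym (count-all inM) ⟩
      count inM + outside        ≡⟨ cong (_+ outside) (trans (length-filter-split inM isM (allFin m)) (cong (_+ rest) M-only)) ⟩
      suc rest + outside         ≡⟨ cong suc (+-comm rest outside) ⟩
      suc (outside + rest)       ∎)
      where open ≡-Reasoning
    outside-∣ : r ∣ outside
    outside-∣ = Blocks.union-of-blocks-∣ Z P r (λ j → not (inM j))
      (λ {i} {j} i∉ Zij → cong not (¬-not (λ Zmj → true≢false (trans (sym (∼-trans Zmj (∼-sym Zij))) (not-true⁻ i∉)))))
      (λ i i∉ → admissible⁻-other-blocks r 1 k Z adm i (¬-not (λ ZiM → true≢false (trans (sym (∼-sym ZiM)) (not-true⁻ i∉)))))

  splitOff-admissible : ∀ Z → admissible r 1 k Z ≡ true → admissible r 1 k (splitOff Z) ≡ true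
  splitOff-admissible Z adm = admissible⁺ r 1 k (splitOff Z) P̃ (λ i _ → blockSize-pos (splitOff Z) P̃ i) other-blocks
    where
    P : IsPartition Z
    P = admissible⁻-partition r 1 k Z adm
    P̃ : IsPartition (splitOff Z)
    P̃ = splitOff-partition Z P
    open IsEquivalence P renaming (refl to ∼-refl; sym to ∼-sym; trans to ∼-trans)
    other-blocks : ∀ i → rel (splitOff Z) i M ≡ false → r ∣ blockSize (splitOff Z) i
    other-blocks i Z̃iM = subst (r ∣_) (sym (blockSize-splitOff Z i isMi)) (by-cases (rel Z i M) refl)
      where
      isMi : isM i ≡ false
      isMi = ¬-not (λ h → true≢false (trans (sym (subst (λ t → rel (splitOff Z) t M ≡ true) (sym (isM-true {i} h))
                                                       (IsEquivalence.refl P̃ {M}))) Z̃iM))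
      by-cases : ∀ b → rel Z i M ≡ b → r ∣ count (λ j → rel Z i j ∧ not (isM j))
      -- i lies in the block of M: its Z̃-block is that block minus M
      by-cases true ZiM = subst (r ∣_)
        (cong length (filter-cong _ _ (allFin m) (λ j _ →
           cong (_∧ not (isM j)) (⇔ᵇ-≡ (∼-trans ZiM) (∼-trans (∼-sym ZiM))))))
        (block-of-M-minus-M-∣ Z adm)
      -- i lies in another block of Z, which Z̃ leaves intact
      by-cases false ZiM = subst (r ∣_)
        (cong length (filter-cong _ _ (allFin m) (λ j _ → ⇔ᵇ-≡ (λ Zij → ∧-intro Zij (j≢M Zij)) (∧-conicalˡ _ _))))
        (admissible⁻-other-blocks r 1 k Z adm i ZiM)
        where
        j≢M : ∀ {j} → rel Z i j ≡ true → not (isM j) ≡ true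
        j≢M {j} Zij = cong not (¬-not (λ isMj → true≢false (trans (sym (subst (λ t → rel Z i t ≡ true) (isM-true isMj) Zij)) ZiM)))

  below-splitOff⁺ : ∀ W Z → IsPartition W → refines W Z ≡ true → MAlone W ≡ true → refines W (splitOff Z) ≡ true
  below-splitOff⁺ W Z P W⊑Z alone = refines⁺ W (splitOff Z) (λ i j Wij →
    splitOff⁺ Z i j (refines⁻ W Z W⊑Z i j Wij) (MAlone-respects-isM W P alone i j Wij))

  below-splitOff⁻ : ∀ W Z → refines W (splitOff Z) ≡ true → refines W Z ≡ true × MAlone W ≡ true
  below-splitOff⁻ W Z W⊑Z̃ =
    refines⁺ W Z (λ i j Wij → proj₁ (splitOff⁻ Z i j (refines⁻ W (splitOff Z) W⊑Z̃ i j Wij))) ,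
    allFin⁺ _ (λ i → ⇒ᵇ-intro (λ WMi → trans (sym (proj₂ (splitOff⁻ Z M i (refines⁻ W (splitOff Z) W⊑Z̃ M i WMi))))
                                             (dec-true (M Fin.≟ M) refl)))

  S-below-interval : ∀ z → z ∈ Π → S z ≡ false →
    ∃[ c ] c ∈ Π × bot ≢ c × (∀ w → w ∈ Π → (w ⊏ z ∧ S w) ≡ PiLeq w c)
  S-below-interval nothing  _  ()
  S-below-interval (just Z) Z∈ Z∉S =
    just (splitOff Z) , ∈-PiElements⁺ r 1 k (splitOff Z) (splitOff-admissible Z (∈-PiElements⁻ r 1 k Z Z∈)) , (λ ()) , S-below-Z
    where
    S-below-Z : ∀ w → w ∈ Π → (w ⊏ just Z ∧ S w) ≡ PiLeq w (just (splitOff Z))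
    S-below-Z nothing _ rewrite dec-false (nothing ≟Pi just Z) (λ ()) = refl
    S-below-Z (just W) W∈ = ⇔ᵇ-≡
      (λ h → below-splitOff⁺ W Z (admissible⁻-partition r 1 k W (∈-PiElements⁻ r 1 k W W∈))
                (∧-conicalˡ _ _ (∧-conicalˡ _ _ h)) (∧-conicalʳ (just W ⊏ just Z) _ h))
      (λ W⊑Z̃ → let (W⊑Z , alone) = below-splitOff⁻ W Z W⊑Z̃ in
         ∧-intro (∧-intro W⊑Z (cong not (dec-false (just W ≟Pi just Z) (λ { refl → true≢false (trans (sym alone) Z∉S) }))))
                 alone)

  oneBlock : Rel m
  oneBlock = replicate m (replicate m true)

  rel-oneBlock : ∀ i j → rel oneBlock i j ≡ true
  rel-oneBlock i j = trans (cong (λ row → lookup row j) (lookup-replicate i (replicate m true))) (lookup-replicate j true)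

  oneBlock-admissible : admissible r 1 k oneBlock ≡ true
  oneBlock-admissible = admissible⁺ r 1 k oneBlock P (λ i _ → blockSize-pos oneBlock P i)
    (λ i ¬iM → ⊥-elim (true≢false (trans (sym (rel-oneBlock i M)) ¬iM)))
    where
    P : IsPartition oneBlock
    P = record { refl = λ {i} → rel-oneBlock i i ; sym = λ {i} {j} _ → rel-oneBlock j i ; trans = λ {i} {j} {l} _ _ → rel-oneBlock i l }

  top∉S : 1 ≤ k → S top ≡ false
  top∉S 1≤k = all-false⁺ _ (allFin m) (∈-allFin Fin.zero) 0∼M-but-0≢M
    where
    0≢M : isM Fin.zero ≡ false
    0≢M = dec-false (Fin.zero Fin.≟ M) (λ 0≡M → 1≰0 (subst (1 ≤_) (trans (sym (toℕ-fromℕ k)) (sym (cong toℕ 0≡M))) 1≤k))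
      where
      1≰0 : ¬ (1 ≤ 0)
      1≰0 ()
    0∼M-but-0≢M : (rel oneBlock M Fin.zero ⇒ᵇ isM Fin.zero) ≡ false
    0∼M-but-0≢M rewrite rel-oneBlock M Fin.zero | 0≢M = refl

  muPi-vanishes : 1 ≤ k → muPi r 1 k ≡ 0ℤ
  muPi-vanishes 1≤k = μ-vanishes top (∈-PiElements⁺ r 1 k _ oneBlock-admissible) (top∉S 1≤k)
    where open Vanishing S refl S-below-interval

theorem5p5 : (r n : ℕ) → r ≥ 1 → n ≥ 1 → muPi r 1 (r * n) ≡ ℤ.pos 0
theorem5p5 r n r≥1 n≥1 = SplitOff.muPi-vanishes r (r * n) (m∣m*n n) (*-mono-≤ r≥1 n≥1)
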